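{- Let $G$ be a finite connected graph and let $\Gamma$ be a finite group acting harmonically on $G$, with quotient graph $\hat G=G/\Gamma$ and quotient map $\phi:G\to\hat G$. Let $\delta$ be a divisor of degree zero on $G$. Then $\delta=\phi^*(\hat\delta)$ for some divisor $\hat\delta$ of degree zero on $\hat G$ if and only if both of the following hold: (i) $\delta$ is constant on $\Gamma$-orbits, i.e. $\delta(v)=\delta(g\cdot v)$ for all vertices $v$ and all $g\in\Gamma$; (ii) for every vertex $v$, $\delta(v)$ is a multiple of $|\Gamma|/O_v$, where $O_v$ is the number of points in the orbit $\Gamma v$.
   Context: Graphs are finite, connected, may have multiple edges, no loops. A divisor is a function from vertices to $\mathbb{Z}$; its degree is the sum of its values. A group action by graph automorphisms is harmonic if no non-identity element fixes both endpoints of an edge. The quotient graph $G/\Gamma$ has as vertices the $\Gamma$-orbits of vertices and as edges the $\Gamma$-orbits of edges. The pullback of a divisor $\hat D$ on $G/\Gamma$ is $\phi^*(\hat D)(v)=m_\phi(v)\,\hat D(\phi(v))$, where $m_\phi(v)=|\{g\in\Gamma: g\cdot v=v\}|$. -}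

module Defs where

open import Data.Nat as ℕ using (ℕ; zero; suc)
open import Data.Nat.DivMod using (_/_)
open import Data.Integer as ℤ using (ℤ; +_; 0ℤ)
open import Data.Fin using (Fin; zero; suc)
open import Data.Fin.Properties using (any?)
open import Data.Product using (Σ; ∃; _×_; _,_)
open import Data.Sum using (_⊎_)
open import Relation.Nullary using (¬_; Dec; yes; no)
open import Relation.Binary.PropositionalEquality using (_≡_; _≢_)
open import Relation.Binary.Construct.Closure.ReflexiveTransitive using (Star)
open import Algebra.Structures using (IsGroup)
open import Data.Fin using (_≟_)

record Graph : Set where
  field
    n      : ℕ
    m      : ℕ
    src    : Fin m → Fin n
    tgt    : Fin m → Fin n
    noLoop : ∀ e → src e ≢ tgt e

open Graph public

Adjacent : (G : Graph) → Fin (n G) → Fin (n G) → Set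
Adjacent G u v = Σ (Fin (m G)) λ e →
  (src G e ≡ u × tgt G e ≡ v) ⊎ (src G e ≡ v × tgt G e ≡ u)

Connected : Graph → Set
Connected G = ∀ u v → Star (Adjacent G) u v

record FinGroup : Set where
  field
    k       : ℕ
    _·_     : Fin k → Fin k → Fin k
    e       : Fin k
    _⁻¹     : Fin k → Fin k
    isGroup : IsGroup _≡_ _·_ e _⁻¹

open FinGroup public

record Action (G : Graph) (Γ : FinGroup) : Set where
  field
    actV   : Fin (k Γ) → Fin (n G) → Fin (n G)
    actE   : Fin (k Γ) → Fin (m G) → Fin (m G)
    idV    : ∀ v → actV (e Γ) v ≡ v
    idE    : ∀ x → actE (e Γ) x ≡ x
    compV  : ∀ g h v → actV (_·_ Γ g h) v ≡ actV g (actV h v)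
    compE  : ∀ g h x → actE (_·_ Γ g h) x ≡ actE g (actE h x)
    endpts : ∀ g x →
      (src G (actE g x) ≡ actV g (src G x) × tgt G (actE g x) ≡ actV g (tgt G x))
      ⊎ (src G (actE g x) ≡ actV g (tgt G x) × tgt G (actE g x) ≡ actV g (src G x))

open Action public

Harmonic : {G : Graph} {Γ : FinGroup} → Action G Γ → Set
Harmonic {G} {Γ} A = ∀ g x →
  actV A g (src G x) ≡ src G x → actV A g (tgt G x) ≡ tgt G x → g ≡ e Γ

-- The vertex part of the quotient graph G/Γ: a surjection φ onto Fin n̂
-- whose fibres are exactly the Γ-orbits.
record VertexQuotient {G : Graph} {Γ : FinGroup} (A : Action G Γ) : Set where
  field
    n̂       : ℕ
    φ        : Fin (n G) → Fin n̂
    surj     : ∀ x → ∃ λ v → φ v ≡ x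
    fibres   : ∀ u v → (φ u ≡ φ v → ∃ λ g → actV A g u ≡ v)
                     × ((∃ λ g → actV A g u ≡ v) → φ u ≡ φ v)

open VertexQuotient public

Divisor : ℕ → Set
Divisor N = Fin N → ℤ

deg : {N : ℕ} → Divisor N → ℤ
deg {zero}  D = 0ℤ
deg {suc N} D = D zero ℤ.+ deg (λ i → D (suc i))

count : {N : ℕ} → (P : Fin N → Set) → (∀ i → Dec (P i)) → ℕ
count {zero}  P P? = 0
count {suc N} P P? with P? zero
... | yes _ = suc (count (λ i → P (suc i)) (λ i → P? (suc i)))
... | no  _ = count (λ i → P (suc i)) (λ i → P? (suc i))

-- m_φ(v) = |{g ∈ Γ : g·v = v}|
stabSize : {G : Graph} {Γ : FinGroup} → Action G Γ → Fin (n G) → ℕ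
stabSize A v = count (λ g → actV A g v ≡ v) (λ g → actV A g v ≟ v)

orbitSize : {G : Graph} {Γ : FinGroup} → Action G Γ → Fin (n G) → ℕ
orbitSize {G} {Γ} A v =
  count (λ w → ∃ λ g → actV A g v ≡ w) (λ w → any? (λ g → actV A g v ≟ w))

-- natural-number division; the divisor-zero case never occurs for orbit sizes
divN : ℕ → ℕ → ℕ
divN a zero    = 0
divN a (suc b) = a / suc b

pullback : {G : Graph} {Γ : FinGroup} {A : Action G Γ} →
           (Q : VertexQuotient A) → Divisor (n̂ Q) → Divisor (n G)
pullback {A = A} Q D̂ v = + stabSize A v ℤ.* D̂ (φ Q v)

-- Counting the pairs (g, w) with g · v = w in two ways gives orbit–stabiliser,
-- |Γ| = O_v · m_φ(v), so condition (ii) says m_φ(v) ∣ δ(v); moreover m_φ is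
-- constant on orbits. An invariant δ with m_φ(v) ∣ δ(v) is therefore the
-- pullback of δ̂(x) := δ(v) / m_φ(v) for any v over x, and every pullback is
-- invariant with m_φ(v) ∣ φ*(δ̂)(v). For degrees, summing m_φ over a fibre
-- counts each element of Γ once, so deg φ*(δ̂) = |Γ| · deg δ̂ and δ̂ has degree
-- zero exactly when its pullback does.
module Submission where

open import Defs
open import Data.Integer using (ℤ; +_; 0ℤ)
open import Data.Integer.Divisibility using (_∣_)
open import Data.Fin using (Fin)
open import Data.Product using (Σ; _×_)
open import Function.Bundles using (_⇔_)
open import Relation.Binary.PropositionalEquality using (_≡_)

open import Data.Nat as ℕ using (ℕ; zero; suc)
import Data.Nat.Properties as ℕ
open import Data.Nat.DivMod using (_/_; m*n/n≡m)
import Data.Integer as ℤ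
open import Data.Integer using (1ℤ)
import Data.Integer.Properties as ℤ
import Data.Integer.Divisibility.Signed as Signed
open import Data.Fin using (zero; suc; _≟_)
open import Data.Fin.Properties using (suc-injective; ¬Fin0; any?)
open import Data.Fin.Permutation using (permutation)
open import Data.Product using (_,_; proj₁; proj₂; ∃)
open import Data.Sum using (inj₁; inj₂)
open import Data.Empty using (⊥-elim)
open import Relation.Nullary using (Dec; yes; no; ¬_)
open import Relation.Binary.PropositionalEquality
  using (_≢_; refl; sym; trans; cong; cong₂; subst; module ≡-Reasoning)
open import Algebra.Structures using (IsGroup)
open import Algebra.Properties.Group using (⁻¹-involutive)
import Algebra.Properties.Semiring.Sum as SemiringSum
open import Function.Bundles using (mk⇔; module Equivalence)

open SemiringSum ℤ.+-*-semiring
  using (sum; sum-cong-≗; sum-replicate-zero; ∑-comm; ∑-permute; *-distribˡ-sum; *-distribʳ-sum)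

indicator : {P : Set} → Dec P → ℤ
indicator (yes _) = 1ℤ
indicator (no _)  = 0ℤ

indicator-cong : {P Q : Set} → (P → Q) → (Q → P) →
                 (p : Dec P) (q : Dec Q) → indicator p ≡ indicator q
indicator-cong f g (yes _) (yes _) = refl
indicator-cong f g (yes p) (no ¬q) = ⊥-elim (¬q (f p))
indicator-cong f g (no ¬p) (yes q) = ⊥-elim (¬p (g q))
indicator-cong f g (no _)  (no _)  = refl

deg≡sum : {N : ℕ} (D : Divisor N) → deg D ≡ sum D
deg≡sum {zero}  D = refl
deg≡sum {suc N} D = cong (λ s → D zero ℤ.+ s) (deg≡sum (λ i → D (suc i)))

deg-cong : {N : ℕ} {D D′ : Divisor N} → (∀ v → D v ≡ D′ v) → deg D ≡ deg D′
deg-cong {D = D} {D′} D≗D′ = trans (deg≡sum D) (trans (sum-cong-≗ D≗D′) (sym (deg≡sum D′)))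

sum-const-1 : (N : ℕ) → sum {N} (λ _ → 1ℤ) ≡ + N
sum-const-1 zero    = refl
sum-const-1 (suc N) = trans (cong (λ s → 1ℤ ℤ.+ s) (sum-const-1 N)) (sym (ℤ.pos-+ 1 N))

sum-select : {N : ℕ} (c : Fin N) (f : Fin N → ℤ) →
             sum (λ w → indicator (c ≟ w) ℤ.* f w) ≡ f c
sum-select {suc N} zero f = begin
    1ℤ ℤ.* f zero ℤ.+ sum (λ w → 0ℤ ℤ.* f (suc w))
  ≡⟨ cong₂ ℤ._+_ (ℤ.*-identityˡ (f zero)) (sum-replicate-zero N) ⟩
    f zero ℤ.+ 0ℤ
  ≡⟨ ℤ.+-identityʳ (f zero) ⟩
    f zero ∎
  where open ≡-Reasoning
sum-select {suc N} (suc c) f = begin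
    0ℤ ℤ.+ sum (λ w → indicator (suc c ≟ suc w) ℤ.* f (suc w))
  ≡⟨ ℤ.+-identityˡ _ ⟩
    sum (λ w → indicator (suc c ≟ suc w) ℤ.* f (suc w))
  ≡⟨ sum-cong-≗ (λ w → cong (ℤ._* f (suc w))
       (indicator-cong suc-injective (cong suc) (suc c ≟ suc w) (c ≟ w))) ⟩
    sum (λ w → indicator (c ≟ w) ℤ.* f (suc w))
  ≡⟨ sum-select c (λ w → f (suc w)) ⟩
    f (suc c) ∎
  where open ≡-Reasoning

count≡sum-indicator : {N : ℕ} (P : Fin N → Set) (P? : ∀ i → Dec (P i)) →
                      + count P P? ≡ sum (λ i → indicator (P? i))
count≡sum-indicator {zero}  P P? = refl
count≡sum-indicator {suc N} P P? with P? zero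
... | yes _ = trans (ℤ.pos-+ 1 _) (cong (λ s → 1ℤ ℤ.+ s) (count≡sum-indicator _ (λ i → P? (suc i))))
... | no _  = trans (count≡sum-indicator _ (λ i → P? (suc i))) (sym (ℤ.+-identityˡ _))

count≡0 : {N : ℕ} (P : Fin N → Set) (P? : ∀ i → Dec (P i)) →
          (∀ i → ¬ P i) → count P P? ≡ 0
count≡0 {zero}  P P? ¬P = refl
count≡0 {suc N} P P? ¬P with P? zero
... | yes p = ⊥-elim (¬P zero p)
... | no _  = count≡0 _ (λ i → P? (suc i)) (λ i → ¬P (suc i))

count-cong-bijection :
  {K : ℕ} (P Q : Fin K → Set) (P? : ∀ i → Dec (P i)) (Q? : ∀ i → Dec (Q i))
  (σ τ : Fin K → Fin K) → (∀ i → τ (σ i) ≡ i) → (∀ j → σ (τ j) ≡ j) →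
  (∀ i → P i → Q (σ i)) → (∀ j → Q j → P (τ j)) → count P P? ≡ count Q Q?
count-cong-bijection P Q P? Q? σ τ τσ≗id στ≗id P⇒Qσ Q⇒Pτ = ℤ.+-injective (begin
    + count P P?                         ≡⟨ count≡sum-indicator P P? ⟩
    sum (λ i → indicator (P? i))         ≡⟨ sum-cong-≗ (λ i → indicator-cong (P⇒Qσ i)
                                              (λ q → subst P (τσ≗id i) (Q⇒Pτ (σ i) q))
                                              (P? i) (Q? (σ i))) ⟩
    sum (λ i → indicator (Q? (σ i)))     ≡⟨ sym (∑-permute (λ i → indicator (Q? i))
                                                  (permutation σ τ στ≗id τσ≗id)) ⟩
    sum (λ i → indicator (Q? i))         ≡⟨ sym (count≡sum-indicator Q Q?) ⟩
    + count Q Q?                         ∎)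
  where open ≡-Reasoning

order≢0 : (Γ : FinGroup) → k Γ ≢ 0
order≢0 Γ k≡0 = ¬Fin0 (subst Fin k≡0 (e Γ))

module OrbitStabiliser {G : Graph} {Γ : FinGroup} (A : Action G Γ) where
  open IsGroup (isGroup Γ) using (assoc; inverseˡ; inverseʳ; identityˡ)

  private
    _∙_ = _·_ Γ
    _⁻¹′ = _⁻¹ Γ
    act = actV A

  act-inverseˡ : ∀ g v → act (g ⁻¹′) (act g v) ≡ v
  act-inverseˡ g v = trans (sym (compV A (g ⁻¹′) g v))
                           (trans (cong (λ h → act h v) (inverseˡ g)) (idV A v))

  transporters : Fin (n G) → Fin (n G) → ℕ
  transporters a b = count (λ h → act h a ≡ b) (λ h → act h a ≟ b)

  transporters≡stabSizeˡ : ∀ g a b → act g a ≡ b → transporters a b ≡ stabSize A a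
  transporters≡stabSizeˡ g a b g·a≡b =
    count-cong-bijection _ _ (λ h → act h a ≟ b) (λ h → act h a ≟ a)
      (g ⁻¹′ ∙_) (g ∙_)
      (λ h → trans (sym (assoc g (g ⁻¹′) h)) (trans (cong (_∙ h) (inverseʳ g)) (identityˡ h)))
      (λ h → trans (sym (assoc (g ⁻¹′) g h)) (trans (cong (_∙ h) (inverseˡ g)) (identityˡ h)))
      (λ h h·a≡b → trans (compV A (g ⁻¹′) h a)
                     (trans (cong (act (g ⁻¹′)) (trans h·a≡b (sym g·a≡b))) (act-inverseˡ g a)))
      (λ h h·a≡a → trans (compV A g h a) (trans (cong (act g) h·a≡a) g·a≡b))

  transporters-sym : ∀ a b → transporters a b ≡ transporters b a
  transporters-sym a b =
    count-cong-bijection _ _ (λ h → act h a ≟ b) (λ h → act h b ≟ a)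
      _⁻¹′ _⁻¹′ (⁻¹-involutive group) (⁻¹-involutive group)
      (λ h h·a≡b → trans (cong (act (h ⁻¹′)) (sym h·a≡b)) (act-inverseˡ h a))
      (λ h h·b≡a → trans (cong (act (h ⁻¹′)) (sym h·b≡a)) (act-inverseˡ h b))
    where group = record { isGroup = isGroup Γ }

  transporters≡stabSizeʳ : ∀ g a b → act g a ≡ b → transporters a b ≡ stabSize A b
  transporters≡stabSizeʳ g a b g·a≡b = trans (transporters-sym a b)
    (transporters≡stabSizeˡ (g ⁻¹′) b a
      (trans (cong (act (g ⁻¹′)) (sym g·a≡b)) (act-inverseˡ g a)))

  stabSize-act : ∀ g a → stabSize A (act g a) ≡ stabSize A a
  stabSize-act g a = trans (sym (transporters≡stabSizeʳ g a _ refl))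
                           (transporters≡stabSizeˡ g a _ refl)

  transporters≡0 : ∀ a b → ¬ (∃ λ g → act g a ≡ b) → transporters a b ≡ 0
  transporters≡0 a b a≁b = count≡0 _ _ (λ h h·a≡b → a≁b (h , h·a≡b))

  sum-transporters : ∀ a → sum (λ w → + transporters a w) ≡ + k Γ
  sum-transporters a = begin
      sum (λ w → + transporters a w)
    ≡⟨ sum-cong-≗ (λ w → count≡sum-indicator _ (λ h → act h a ≟ w)) ⟩
      sum (λ w → sum (λ h → indicator (act h a ≟ w)))
    ≡⟨ ∑-comm (λ w h → indicator (act h a ≟ w)) ⟩
      sum (λ h → sum (λ w → indicator (act h a ≟ w)))
    ≡⟨ sum-cong-≗ (λ h → sum-cong-≗ (λ w → sym (ℤ.*-identityʳ (indicator (act h a ≟ w))))) ⟩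
      sum (λ h → sum (λ w → indicator (act h a ≟ w) ℤ.* 1ℤ))
    ≡⟨ sum-cong-≗ (λ h → sum-select (act h a) (λ _ → 1ℤ)) ⟩
      sum {k Γ} (λ _ → 1ℤ)
    ≡⟨ sum-const-1 (k Γ) ⟩
      + k Γ ∎
    where open ≡-Reasoning

  orbit-stabiliser : ∀ a → k Γ ≡ orbitSize A a ℕ.* stabSize A a
  orbit-stabiliser a = ℤ.+-injective (begin
      + k Γ
    ≡⟨ sym (sum-transporters a) ⟩
      sum (λ w → + transporters a w)
    ≡⟨ sum-cong-≗ transporters≡indicator ⟩
      sum (λ w → indicator (inOrbit? w) ℤ.* + stabSize A a)
    ≡⟨ sym (*-distribʳ-sum (+ stabSize A a) (λ w → indicator (inOrbit? w))) ⟩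
      sum (λ w → indicator (inOrbit? w)) ℤ.* + stabSize A a
    ≡⟨ cong (ℤ._* + stabSize A a) (sym (count≡sum-indicator _ inOrbit?)) ⟩
      + orbitSize A a ℤ.* + stabSize A a
    ≡⟨ sym (ℤ.pos-* (orbitSize A a) (stabSize A a)) ⟩
      + (orbitSize A a ℕ.* stabSize A a) ∎)
    where
    open ≡-Reasoning
    inOrbit? : ∀ w → Dec (∃ λ g → act g a ≡ w)
    inOrbit? w = any? (λ g → act g a ≟ w)
    transporters≡indicator : ∀ w → + transporters a w ≡ indicator (inOrbit? w) ℤ.* + stabSize A a
    transporters≡indicator w with inOrbit? w
    ... | yes (g , g·a≡w) = trans (cong +_ (transporters≡stabSizeˡ g a w g·a≡w))
                                  (sym (ℤ.*-identityˡ _))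
    ... | no a≁w = cong +_ (transporters≡0 a w a≁w)

  divN-order-orbitSize : ∀ a → divN (k Γ) (orbitSize A a) ≡ stabSize A a
  divN-order-orbitSize a with orbitSize A a | orbit-stabiliser a
  ... | zero  | k≡0 = ⊥-elim (order≢0 Γ k≡0)
  ... | suc o | k≡o*s = begin
      k Γ / suc o                  ≡⟨ cong (_/ suc o) (trans k≡o*s (ℕ.*-comm (suc o) _)) ⟩
      stabSize A a ℕ.* suc o / suc o ≡⟨ m*n/n≡m (stabSize A a) (suc o) ⟩
      stabSize A a                 ∎
    where open ≡-Reasoning

  orbitIndex∣⇔stabSize∣ : ∀ a {i} →
                          (+ divN (k Γ) (orbitSize A a) ∣ i) ⇔ (+ stabSize A a Signed.∣ i)
  orbitIndex∣⇔stabSize∣ a {i} = mk⇔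
    (λ d∣i → Signed.∣ᵤ⇒∣ (subst (λ s → + s ∣ i) (divN-order-orbitSize a) d∣i))
    (λ s∣i → subst (λ s → + s ∣ i) (sym (divN-order-orbitSize a)) (Signed.∣⇒∣ᵤ s∣i))

module Pullback {G : Graph} {Γ : FinGroup} {A : Action G Γ} (Q : VertexQuotient A) where
  open OrbitStabiliser A

  lift : Fin (n̂ Q) → Fin (n G)
  lift x = proj₁ (surj Q x)

  sum-stabSize-fibre : ∀ x → sum (λ v → indicator (φ Q v ≟ x) ℤ.* + stabSize A v) ≡ + k Γ
  sum-stabSize-fibre x = trans (sum-cong-≗ fibre≡transporters) (sum-transporters (lift x))
    where
    fibre≡transporters : ∀ v → indicator (φ Q v ≟ x) ℤ.* + stabSize A v ≡ + transporters (lift x) v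
    fibre≡transporters v with φ Q v ≟ x
    ... | yes φv≡x with proj₁ (fibres Q (lift x) v) (trans (proj₂ (surj Q x)) (sym φv≡x))
    ... | g , g·x̃≡v = trans (ℤ.*-identityˡ _) (cong +_ (sym (transporters≡stabSizeʳ g _ v g·x̃≡v)))
    fibre≡transporters v | no φv≢x = cong +_ (sym (transporters≡0 (lift x) v
      (λ g·x̃≡v → φv≢x (trans (sym (proj₂ (fibres Q _ v) g·x̃≡v)) (proj₂ (surj Q x))))))

  deg-pullback : (D : Divisor (n̂ Q)) → deg (pullback Q D) ≡ + k Γ ℤ.* deg D
  deg-pullback D = begin
      deg (pullback Q D)
    ≡⟨ deg≡sum (pullback Q D) ⟩
      sum (λ v → + stabSize A v ℤ.* D (φ Q v))
    ≡⟨ sum-cong-≗ (λ v → sym (sum-select (φ Q v) (λ x → + stabSize A v ℤ.* D x))) ⟩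
      sum (λ v → sum (λ x → indicator (φ Q v ≟ x) ℤ.* (+ stabSize A v ℤ.* D x)))
    ≡⟨ ∑-comm (λ v x → indicator (φ Q v ≟ x) ℤ.* (+ stabSize A v ℤ.* D x)) ⟩
      sum (λ x → sum (λ v → indicator (φ Q v ≟ x) ℤ.* (+ stabSize A v ℤ.* D x)))
    ≡⟨ sum-cong-≗ fibre-sum ⟩
      sum (λ x → + k Γ ℤ.* D x)
    ≡⟨ sym (*-distribˡ-sum (+ k Γ) D) ⟩
      + k Γ ℤ.* sum D
    ≡⟨ cong (+ k Γ ℤ.*_) (sym (deg≡sum D)) ⟩
      + k Γ ℤ.* deg D ∎
    where
    open ≡-Reasoning
    fibre-sum : ∀ x → sum (λ v → indicator (φ Q v ≟ x) ℤ.* (+ stabSize A v ℤ.* D x))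
                      ≡ + k Γ ℤ.* D x
    fibre-sum x = begin
        sum (λ v → indicator (φ Q v ≟ x) ℤ.* (+ stabSize A v ℤ.* D x))
      ≡⟨ sum-cong-≗ (λ v → sym (ℤ.*-assoc (indicator (φ Q v ≟ x)) _ (D x))) ⟩
        sum (λ v → indicator (φ Q v ≟ x) ℤ.* + stabSize A v ℤ.* D x)
      ≡⟨ sym (*-distribʳ-sum (D x) (λ v → indicator (φ Q v ≟ x) ℤ.* + stabSize A v)) ⟩
        sum (λ v → indicator (φ Q v ≟ x) ℤ.* + stabSize A v) ℤ.* D x
      ≡⟨ cong (ℤ._* D x) (sum-stabSize-fibre x) ⟩
        + k Γ ℤ.* D x ∎

  deg≡0-of-deg-pullback≡0 : (D : Divisor (n̂ Q)) → deg (pullback Q D) ≡ 0ℤ → deg D ≡ 0ℤ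
  deg≡0-of-deg-pullback≡0 D deg-φ*D≡0
    with ℤ.i*j≡0⇒i≡0∨j≡0 (+ k Γ) (trans (sym (deg-pullback D)) deg-φ*D≡0)
  ... | inj₁ k≡0     = ⊥-elim (order≢0 Γ (ℤ.+-injective k≡0))
  ... | inj₂ degD≡0 = degD≡0

  pullback-act : (D : Divisor (n̂ Q)) → ∀ v g → pullback Q D v ≡ pullback Q D (actV A g v)
  pullback-act D v g = cong₂ (λ s x → + s ℤ.* D x)
    (sym (stabSize-act g v)) (proj₂ (fibres Q v (actV A g v)) (g , refl))

  stabSize∣pullback : (D : Divisor (n̂ Q)) → ∀ v → + stabSize A v Signed.∣ pullback Q D v
  stabSize∣pullback D v = Signed.divides (D (φ Q v)) (ℤ.*-comm (+ stabSize A v) _)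

  descend : (δ : Divisor (n G)) → (∀ v g → δ v ≡ δ (actV A g v)) →
            (∀ v → + stabSize A v Signed.∣ δ v) →
            Σ (Divisor (n̂ Q)) λ δ̂ → ∀ v → δ v ≡ pullback Q δ̂ v
  descend δ invariant divisible = (λ x → quotient (lift x)) , δ≡φ*δ̂
    where
    quotient : Fin (n G) → ℤ
    quotient v = Signed._∣_.quotient (divisible v)
    δ≡φ*δ̂ : ∀ v → δ v ≡ + stabSize A v ℤ.* quotient (lift (φ Q v))
    δ≡φ*δ̂ v with proj₁ (fibres Q (lift (φ Q v)) v) (proj₂ (surj Q (φ Q v)))
    ... | g , g·w≡v = begin
        δ v                              ≡⟨ cong δ (sym g·w≡v) ⟩
        δ (actV A g w)                   ≡⟨ sym (invariant w g) ⟩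
        δ w                              ≡⟨ Signed._∣_.equality (divisible w) ⟩
        quotient w ℤ.* + stabSize A w    ≡⟨ ℤ.*-comm (quotient w) _ ⟩
        + stabSize A w ℤ.* quotient w    ≡⟨ cong (λ s → + s ℤ.* quotient w) stab-w≡stab-v ⟩
        + stabSize A v ℤ.* quotient w    ∎
      where
      open ≡-Reasoning
      w = lift (φ Q v)
      stab-w≡stab-v : stabSize A w ≡ stabSize A v
      stab-w≡stab-v = trans (sym (stabSize-act g w)) (cong (stabSize A) g·w≡v)

lemma4p1 : (G : Graph) → Connected G → (Γ : FinGroup) → (A : Action G Γ) →
    Harmonic A → (Q : VertexQuotient A) → (δ : Divisor (n G)) → deg δ ≡ 0ℤ →
    (Σ (Divisor (n̂ Q)) (λ δ̂ → deg δ̂ ≡ 0ℤ × (∀ v → δ v ≡ pullback Q δ̂ v)))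
    ⇔ ((∀ v g → δ v ≡ δ (actV A g v))
    × (∀ v → (+ divN (k Γ) (orbitSize A v)) ∣ δ v))
lemma4p1 G _ Γ A _ Q δ deg-δ≡0 = mk⇔
  (λ (δ̂ , _ , δ≡φ*δ̂) →
      (λ v g → trans (δ≡φ*δ̂ v) (trans (pullback-act δ̂ v g) (sym (δ≡φ*δ̂ _))))
    , (λ v → Equivalence.from (orbitIndex∣⇔stabSize∣ v)
               (subst (_ Signed.∣_) (sym (δ≡φ*δ̂ v)) (stabSize∣pullback δ̂ v))))
  (λ (invariant , divisible) →
      let (δ̂ , δ≡φ*δ̂) = descend δ invariant
                           (λ v → Equivalence.to (orbitIndex∣⇔stabSize∣ v) (divisible v))
          deg-φ*δ̂≡0 = trans (sym (deg-cong δ≡φ*δ̂)) deg-δ≡0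
      in δ̂ , deg≡0-of-deg-pullback≡0 δ̂ deg-φ*δ̂≡0 , δ≡φ*δ̂)
  where
  open OrbitStabiliser A
  open Pullback Q
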